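{- Let $t$ be a positive integer, let $(T,<,\{G_x\}_{x\in V(T)})$ be a delayed structured tree with realization $(G_T,<)$, and let $\mathcal I$ be an interval family of $(T,<)$ forming a complete interval minor in $(G_T,<)$. If $\mathcal I$ has a $(2t-1)$-interval path in $T$, then $T$ has a $(2t-3)$-heavy leaf.
   Context: For a rooted tree $T$, $L(T)$ is its set of leaves and $L(x)$ the set of leaves descending from a node $x$; the ancestors of a node include the node itself, and $p^2(x)$ denotes the grandparent of $x$. An ordered tree $(T,<)$ is a rooted tree with a linear order $<$ on $L(T)$ such that each $L(x)$ is an interval of $<$. A delayed structured tree $(T,<,\{G_x\})$ is an ordered tree in which every leaf is the only child of its parent, with, for each node $x$, a graph $G_x$ on the set of grandchildren of $x$. Its realization $(G_T,<)$ is the ordered graph on $L(T)$ ordered by $<$, where leaves $u,v$ are adjacent iff $u'v'\in E(G_z)$, $z$ being the closest common ancestor of $u,v$ and $u',v'$ the grandchildren of $z$ that are ancestors of $u,v$. An interval family of $(T,<)$ is a set $\mathcal I$ of pairwise disjoint intervals of $(L(T),<)$; it forms a complete interval minor in $(G_T,<)$ if for any two distinct intervals of $\mathcal I$ there is an edge of $G_T$ with one endpoint in each. An $\ell$-interval path is a sequence $I_1,\dots,I_\ell$ of intervals of $\mathcal I$ for which there exist nodes $x_1,\dots,x_\ell$ with $I_j\cup\dots\cup I_\ell\subseteq L(x_j)$ for all $j$ and $L(x_j)\cap I_{j-1}=\emptyset$ for $j\ge2$. A leaf $y$ is $h$-heavy if at least $h$ ancestors $x$ of $y$ (having a grandparent)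 are not isolated in the graph $G_{p^2(x)}$. -}

module Defs where

open import Data.Nat using (ℕ; zero; suc; _≤_)
open import Data.Fin using (Fin; toℕ)
open import Data.Product using (Σ; ∃; _×_; _,_; ∃-syntax)
open import Data.Sum using (_⊎_)
open import Data.Empty using (⊥)
open import Relation.Binary.PropositionalEquality using (_≡_; _≢_)
open import Relation.Nullary using (¬_)
open import Function.Definitions using (Injective)

iter : ∀ {A : Set} → (A → A) → ℕ → A → A
iter f zero a = a
iter f (suc k) a = f (iter f k a)

-- Convention: parent root ≡ root; every node reaches the root by
-- iterating parent (this rules out cycles, so this is exactly a rooted tree).
record RootedTree (n : ℕ) : Set where
  field
    root : Fin n
    parent : Fin n → Fin n
    parent-root : parent root ≡ root
    reaches-root : ∀ x → ∃[ k ] iter parent k x ≡ root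

  Ancestor : Fin n → Fin n → Set
  Ancestor x y = ∃[ k ] iter parent k y ≡ x

  Child : Fin n → Fin n → Set
  Child y x = y ≢ root × parent y ≡ x

  Leaf : Fin n → Set
  Leaf x = ∀ y → ¬ Child y x

  L : Fin n → Fin n → Set
  L x y = Leaf y × Ancestor x y

  HasGrandparent : Fin n → Set
  HasGrandparent x = x ≢ root × parent x ≢ root

  p² : Fin n → Fin n
  p² x = parent (parent x)

  Grandchild : Fin n → Fin n → Set
  Grandchild g x = HasGrandparent g × p² g ≡ x

  ClosestCommonAncestor : Fin n → Fin n → Fin n → Set
  ClosestCommonAncestor z u v =
    Ancestor z u × Ancestor z v × (∀ w → Ancestor w u → Ancestor w v → Ancestor w z)

Convex : ∀ {n} → (Fin n → Set) → (Fin n → Fin n → Set) → (Fin n → Set) → Set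
Convex Leaf _≺_ P = ∀ u w v → Leaf w → P u → P v → u ≺ w → w ≺ v → P w

record OrderedTree (n : ℕ) : Set₁ where
  field
    tree : RootedTree n
  open RootedTree tree public
  field
    _≺_ : Fin n → Fin n → Set
    ≺-irrefl : ∀ u → Leaf u → ¬ (u ≺ u)
    ≺-trans : ∀ u v w → Leaf u → Leaf v → Leaf w → u ≺ v → v ≺ w → u ≺ w
    ≺-total : ∀ u v → Leaf u → Leaf v → u ≢ v → (u ≺ v) ⊎ (v ≺ u)
    L-convex : ∀ x → Convex Leaf _≺_ (L x)

  Interval : (Fin n → Set) → Set
  Interval P = (∀ u → P u → Leaf u) × (∃[ u ] P u) × Convex Leaf _≺_ P

-- A delayed structured tree: every leaf is the only child of its parent,
-- and each node x carries a (simple, undirected) graph G_x on its grandchildren,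
-- with edge relation E x.
record DelayedStructuredTree (n : ℕ) : Set₁ where
  field
    ordered : OrderedTree n
  open OrderedTree ordered public
  field
    delayed : ∀ y → Leaf y → (y ≢ root) × (∀ z → Child z (parent y) → z ≡ y)
    E : Fin n → Fin n → Fin n → Set
    E-vertices : ∀ x u v → E x u v → Grandchild u x × Grandchild v x
    E-sym : ∀ x u v → E x u v → E x v u
    E-irrefl : ∀ x u → ¬ E x u u

  Adjacent : Fin n → Fin n → Set
  Adjacent u v = Leaf u × Leaf v ×
    (∃[ z ] ∃[ u' ] ∃[ v' ] ClosestCommonAncestor z u v ×
      Grandchild u' z × Ancestor u' u × Grandchild v' z × Ancestor v' v × E z u' v')

  NotIsolated : Fin n → Set
  NotIsolated x = ∃[ w ] E (p² x) x w

  Heavy : ℕ → Fin n → Set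
  Heavy h y = Leaf y × (Σ (Fin h → Fin n) λ f → Injective _≡_ _≡_ f ×
    (∀ i → Ancestor (f i) y × HasGrandparent (f i) × NotIsolated (f i)))

  IsIntervalFamily : ∀ {m} → (Fin m → Fin n → Set) → Set
  IsIntervalFamily I = (∀ i → Interval (I i)) ×
    (∀ i j → i ≢ j → ∀ v → I i v → I j v → ⊥)

  CompleteIntervalMinor : ∀ {m} → (Fin m → Fin n → Set) → Set
  CompleteIntervalMinor I = ∀ i j → i ≢ j → ∃[ u ] ∃[ v ] I i u × I j v × Adjacent u v

  HasIntervalPath : ∀ {m} → (Fin m → Fin n → Set) → ℕ → Set
  HasIntervalPath {m} I ℓ = Σ (Fin ℓ → Fin m) λ s → Σ (Fin ℓ → Fin n) λ x →
    (∀ j k → toℕ j ≤ toℕ k → ∀ v → I (s k) v → L (x j) v) ×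
    (∀ j k → toℕ k ≡ suc (toℕ j) → ∀ v → L (x k) v → I (s j) v → ⊥)

-- Follow the path x₀, …, x_{ℓ-1} down the tree: the nodes x_j form a chain of
-- ancestors above a leaf y of the last interval. For each j ≤ ℓ − 3, the complete
-- interval minor yields an edge between I_j and I_{j+2}; its endpoints' closest common
-- ancestor z lies below x_j but not below x_{j+1}, and the grandchild of z towards
-- I_{j+2} is a non-isolated ancestor of y. These ℓ − 2 nodes are distinct because
-- their grandparents lie in the disjoint ranges between consecutive x_j and x_{j+1}.
module Submission where

open import Defs
open import Data.Nat using (ℕ; zero; suc; _+_; _*_; _∸_; _≤_; _<_; s≤s; _≤?_)
open import Data.Nat.Properties using (m∸n+n≡m; ≤-refl; <⇒≤; ≤-trans; n≤1+n; ≰⇒>; <-cmp; m≤n⇒m<n∨m≡n; +-suc)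
open import Data.Fin as Fin using (Fin; toℕ; fromℕ; inject₁)
open import Data.Fin.Properties using (toℕ-fromℕ; toℕ-inject₁; toℕ-injective; toℕ≤pred[n])
open import Data.Product using (_,_; proj₁; proj₂; ∃-syntax)
open import Data.Sum using (_⊎_; inj₁; inj₂)
open import Data.Empty using (⊥; ⊥-elim)
open import Relation.Nullary using (¬_; yes; no)
open import Relation.Binary using (tri<; tri≈; tri>)
open import Relation.Binary.PropositionalEquality using (_≡_; _≢_; refl; sym; trans; cong; subst; subst₂)
open import Function.Definitions using (Injective)

iter-+ : ∀ {A : Set} (f : A → A) m k a → iter f (m + k) a ≡ iter f m (iter f k a)
iter-+ f zero    k a = refl
iter-+ f (suc m) k a = cong f (iter-+ f m k a)

module Ancestry {n : ℕ} (T : RootedTree n) where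
  open RootedTree T

  ancestor-refl : ∀ x → Ancestor x x
  ancestor-refl x = 0 , refl

  ancestor-trans : ∀ {x y w} → Ancestor x y → Ancestor y w → Ancestor x w
  ancestor-trans {w = w} (j , refl) (k , refl) = j + k , iter-+ parent j k w

  parent-ancestor : ∀ x → Ancestor (parent x) x
  parent-ancestor x = 1 , refl

  iter-ancestor : ∀ v {j k} → k ≤ j → Ancestor (iter parent j v) (iter parent k v)
  iter-ancestor v {j} {k} k≤j =
    j ∸ k , trans (sym (iter-+ parent (j ∸ k) k v)) (cong (λ i → iter parent i v) (m∸n+n≡m k≤j))

  ancestors-linear : ∀ {a b v} → Ancestor a v → Ancestor b v → Ancestor a b ⊎ Ancestor b (parent a)
  ancestors-linear {v = v} (j , refl) (k , refl) with k ≤? j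
  ... | yes k≤j = inj₁ (iter-ancestor v k≤j)
  ... | no  k≰j = inj₂ (iter-ancestor v (≰⇒> k≰j))

  ancestors-comparable : ∀ {a b v} → Ancestor a v → Ancestor b v → Ancestor a b ⊎ Ancestor b a
  ancestors-comparable {a} a≼v b≼v with ancestors-linear a≼v b≼v
  ... | inj₁ a≼b  = inj₁ a≼b
  ... | inj₂ b≼pa = inj₂ (ancestor-trans b≼pa (parent-ancestor a))

  ancestor-below-unless : ∀ {w b c v} → Ancestor w v → Ancestor b v → Ancestor c v →
                          ¬ Ancestor b (p² w) → ¬ Ancestor c b → Ancestor w c
  ancestor-below-unless {w} w≼v b≼v c≼v b⋠p²w c⋠b with ancestors-linear w≼v c≼v
  ... | inj₁ w≼c  = w≼c
  ... | inj₂ c≼pw with ancestors-linear (ancestor-trans (parent-ancestor w) w≼v) b≼v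
  ...   | inj₁ pw≼b  = ⊥-elim (c⋠b (ancestor-trans c≼pw pw≼b))
  ...   | inj₂ b≼p²w = ⊥-elim (b⋠p²w b≼p²w)

module _ {n : ℕ} (T : DelayedStructuredTree n) where
  open DelayedStructuredTree T
  open Ancestry tree

  heavy-zero : ∀ {y} → Leaf y → Heavy 0 y
  heavy-zero y-leaf = y-leaf , (λ ()) , (λ { {()} }) , (λ ())

  module IntervalPath {m h : ℕ} {I : Fin m → Fin n → Set}
    (family : IsIntervalFamily I) (minor : CompleteIntervalMinor I)
    (s : Fin (2 + h) → Fin m) (x : Fin (2 + h) → Fin n)
    (nested : ∀ j k → toℕ j ≤ toℕ k → ∀ v → I (s k) v → L (x j) v)
    (separated : ∀ j k → toℕ k ≡ suc (toℕ j) → ∀ v → L (x k) v → I (s j) v → ⊥)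
    where

    member : ∀ i → ∃[ v ] I i v
    member i = proj₁ (proj₂ (proj₁ family i))

    member-leaf : ∀ {i v} → I i v → Leaf v
    member-leaf {i} {v} = proj₁ (proj₁ family i) v

    later-not-above : ∀ {j k} → toℕ j < toℕ k → ¬ Ancestor (x k) (x j)
    later-not-above {j} {Fin.suc k} (s≤s j≤k) xk≼xj =
      let k⁻ : Fin (2 + h)
          k⁻ = inject₁ k
          w , w∈I = member (s k⁻)
          w-leaf , xj≼w = nested j k⁻ (subst (toℕ j ≤_) (sym (toℕ-inject₁ k)) j≤k) w w∈I
      in separated k⁻ (Fin.suc k) (cong suc (sym (toℕ-inject₁ k))) w (w-leaf , ancestor-trans xk≼xj xj≼w) w∈I

    ancestor-of-later : ∀ {j k} → toℕ j ≤ toℕ k → Ancestor (x j) (x k)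
    ancestor-of-later {j} {k} j≤k with m≤n⇒m<n∨m≡n j≤k
    ... | inj₂ j≡k rewrite toℕ-injective j≡k = ancestor-refl (x k)
    ... | inj₁ j<k with member (s k)
    ...   | w , w∈I with ancestors-comparable (proj₂ (nested j k j≤k w w∈I)) (proj₂ (nested k k ≤-refl w w∈I))
    ...     | inj₁ xj≼xk = xj≼xk
    ...     | inj₂ xk≼xj = ⊥-elim (later-not-above j<k xk≼xj)

    distinct-across : ∀ {a b c} → toℕ b ≡ suc (toℕ a) → toℕ b ≤ toℕ c → s a ≢ s c
    distinct-across {a} {b} {c} b≡1+a b≤c sa≡sc =
      let w , w∈Ic = member (s c)
      in separated a b b≡1+a w (nested b c b≤c w w∈Ic) (subst (λ i → I i w) (sym sa≡sc) w∈Ic)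

    record Crossing (a b c : Fin (2 + h)) : Set where
      field
        node            : Fin n
        node≼xc         : Ancestor node (x c)
        has-grandparent : HasGrandparent node
        not-isolated    : NotIsolated node
        xa≼p²node       : Ancestor (x a) (p² node)
        xb⋠p²node       : ¬ Ancestor (x b) (p² node)

    crossing : ∀ {a b c} → toℕ b ≡ suc (toℕ a) → toℕ b < toℕ c → Crossing a b c
    crossing {a} {b} {c} b≡1+a b<c
      with minor (s a) (s c) (distinct-across b≡1+a (<⇒≤ b<c))
    ... | u , v , u∈Ia , v∈Ic , u-leaf , _ , _ , u′ , v′
        , (z≼u , _ , closest) , _ , _ , (v′-gp , refl) , v′≼v , edge
        = record
          { node            = v′
          ; node≼xc         = ancestor-below-unless v′≼v (proj₂ b-above-v) (proj₂ c-above-v)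
                                xb⋠z (later-not-above b<c)
          ; has-grandparent = v′-gp
          ; not-isolated    = u′ , E-sym _ u′ v′ edge
          ; xa≼p²node       = closest (x a) (proj₂ (nested a a ≤-refl u u∈Ia)) (proj₂ a-above-v)
          ; xb⋠p²node       = xb⋠z
          }
      where
      a-above-v : L (x a) v
      a-above-v = nested a c (≤-trans (subst (toℕ a ≤_) (sym b≡1+a) (n≤1+n _)) (<⇒≤ b<c)) v v∈Ic
      b-above-v : L (x b) v
      b-above-v = nested b c (<⇒≤ b<c) v v∈Ic
      c-above-v : L (x c) v
      c-above-v = nested c c ≤-refl v v∈Ic
      xb⋠z : ¬ Ancestor (x b) (p² v′)
      xb⋠z xb≼z = separated a b b≡1+a u (u-leaf , ancestor-trans xb≼z z≼u) u∈Ia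

    at+0 at+1 at+2 : Fin h → Fin (2 + h)
    at+0 i = inject₁ (inject₁ i)
    at+1 i = Fin.suc (inject₁ i)
    at+2 i = Fin.suc (Fin.suc i)

    toℕ-at+0 : ∀ i → toℕ (at+0 i) ≡ toℕ i
    toℕ-at+0 i = trans (toℕ-inject₁ (inject₁ i)) (toℕ-inject₁ i)

    toℕ-at+1 : ∀ i → toℕ (at+1 i) ≡ suc (toℕ i)
    toℕ-at+1 i = cong suc (toℕ-inject₁ i)

    crossing-at : ∀ i → Crossing (at+0 i) (at+1 i) (at+2 i)
    crossing-at i = crossing (trans (toℕ-at+1 i) (cong suc (sym (toℕ-at+0 i))))
                             (subst (_< toℕ (at+2 i)) (sym (toℕ-at+1 i)) ≤-refl)

    open Crossing

    crossing-node : Fin h → Fin n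
    crossing-node i = node (crossing-at i)

    crossing-nodes-differ : ∀ {i i′} → toℕ i < toℕ i′ → crossing-node i ≢ crossing-node i′
    crossing-nodes-differ {i} {i′} i<i′ same =
      xb⋠p²node (crossing-at i)
        (ancestor-trans (ancestor-of-later (subst₂ _≤_ (sym (toℕ-at+1 i)) (sym (toℕ-at+0 i′)) i<i′))
                        (subst (λ w → Ancestor (x (at+0 i′)) (p² w)) (sym same) (xa≼p²node (crossing-at i′))))

    crossing-node-injective : Injective _≡_ _≡_ crossing-node
    crossing-node-injective {i} {i′} same with <-cmp (toℕ i) (toℕ i′)
    ... | tri< i<i′ _ _ = ⊥-elim (crossing-nodes-differ i<i′ same)
    ... | tri≈ _ i≡i′ _ = toℕ-injective i≡i′
    ... | tri> _ _ i′<i = ⊥-elim (crossing-nodes-differ i′<i (sym same))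

    heavy-leaf : ∃[ y ] Heavy h y
    heavy-leaf =
      let last = fromℕ (suc h)
          y , y∈I = member (s last)
          below-last : ∀ j → Ancestor (x j) y
          below-last j = proj₂ (nested j last (subst (toℕ j ≤_) (sym (toℕ-fromℕ (suc h))) (toℕ≤pred[n] j)) y y∈I)
      in y , member-leaf y∈I , crossing-node , crossing-node-injective ,
         λ i → ancestor-trans (node≼xc (crossing-at i)) (below-last (at+2 i))
             , has-grandparent (crossing-at i) , not-isolated (crossing-at i)

  heavy-leaf-of-interval-path : ∀ {m h} {I : Fin m → Fin n → Set} →
    IsIntervalFamily I → CompleteIntervalMinor I → HasIntervalPath I (2 + h) → ∃[ y ] Heavy h y
  heavy-leaf-of-interval-path family minor (s , x , nested , separated) =
    IntervalPath.heavy-leaf family minor s x nested separated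

2[2+t]∸1≡2+[2[2+t]∸3] : ∀ t → 2 * (2 + t) ∸ 1 ≡ 2 + (2 * (2 + t) ∸ 3)
2[2+t]∸1≡2+[2[2+t]∸3] t rewrite +-suc t (suc (t + 0)) = refl

lemma13 : (t : ℕ) → 1 ≤ t → (n : ℕ) → (T : DelayedStructuredTree n) →
            (m : ℕ) → (I : Fin m → Fin n → Set) →
            DelayedStructuredTree.IsIntervalFamily T I →
            DelayedStructuredTree.CompleteIntervalMinor T I →
            DelayedStructuredTree.HasIntervalPath T I (2 * t ∸ 1) →
            ∃[ y ] DelayedStructuredTree.Heavy T (2 * t ∸ 3) y
lemma13 (suc zero) _ n T m I family _ (s , _) =
  let y , y∈I = proj₁ (proj₂ (proj₁ family (s Fin.zero)))
  in y , heavy-zero T (proj₁ (proj₁ family (s Fin.zero)) y y∈I)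
lemma13 (suc (suc t)) _ n T m I family minor path =
  heavy-leaf-of-interval-path T family minor
    (subst (DelayedStructuredTree.HasIntervalPath T I) (2[2+t]∸1≡2+[2[2+t]∸3] t) path)
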